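{- Let $T$ be a text of length $n$ over $\Sigma$ and consider its implicit suffix tree. Let $(u,d)$ be an implicit node, $S:=\mathrm{str}(u)[1\ldots d]$, and let $\rho(u,d)$ be the number of unique right extensions of $S$, i.e. the number of $y\in\Sigma\cup\{\$\}$ such that $Sy$ occurs exactly once in $T\$$ (where $\$\notin\Sigma$ is a fresh end symbol). Then: (1) if $(u,d)$ lies within an internal edge and $d<\mathrm{depth}(u)$, then $\rho(u,d)=1$; (2) if $d=\mathrm{depth}(u)$ and $u$ is a branching node, then $\rho(u,d)$ equals one plus the number of children $w$ of $u$ that are leaves and such that the edge $uw$ does not contain an implicit node; (3) if $(u,d)$ lies within an external edge, then $\rho(u,d)=2$ if $(u,d)$ is the deepest implicit node on that edge (largest $d$), and $\rho(u,d)=1$ otherwise.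
   Context: $\Sigma$ is a constant-size alphabet. A suffix of $T$ is repeated if it occurs at least twice in $T$. The implicit suffix tree of $T$ is the compacted trie of all suffixes of $T$ (no sentinel appended): from the trie of all suffixes, keep as explicit nodes only the root, the branching nodes (non-root nodes with at least two children) and the leaves (trie nodes with no children, corresponding to the suffixes of $T$ that are not repeated), compressing every other path into a single edge labelled by the concatenated string. For a node $u$: $\mathrm{str}(u)$ is the concatenated edge labels from the root to $u$, $\mathrm{depth}(u)=|\mathrm{str}(u)|$, $\mathrm{parent}(u)$ its parent. A locus is a pair $(u,d)$, $u$ non-root, with $\mathrm{depth}(\mathrm{parent}(u))<d\le\mathrm{depth}(u)$; it lies within the edge $(\mathrm{parent}(u),u)$ and represents $\mathrm{str}(u)[1\ldots d]$. An implicit node is a locus $(u,d)$ such that $\mathrm{str}(u)[1\ldots d]$ is a repeated suffix of $T$. An edge $(p,v)$ is external if $v$ is a leaf and internal otherwise. -}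

module Defs where

open import Data.Nat using (ℕ; zero; suc; _≤_; _<_; _≟_)
open import Data.Fin using (Fin)
import Data.Fin.Properties as FinP
open import Data.Maybe using (Maybe; just; nothing)
import Data.Maybe.Properties as MaybeP
open import Data.List using (List; []; _∷_; _∷ʳ_; _++_; length; take; drop; map; filter; upTo; allFin)
import Data.List.Properties as ListP
open import Data.List.Membership.Propositional using (_∈_)
open import Data.List.Relation.Unary.Unique.Propositional using (Unique)
open import Data.Product using (Σ; ∃; ∃₂; _×_; _,_)
open import Data.Sum using (_⊎_)
open import Relation.Nullary using (¬_)
open import Relation.Binary.PropositionalEquality using (_≡_; _≢_)
open import Relation.Binary.Definitions using (DecidableEquality)
open import Function.Bundles using (_⇔_)

Str : ℕ → Set
Str σ = List (Fin σ)

-- Σ ∪ {$}: `just c` is the letter c, `nothing` is the fresh end symbol $.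
Ext : ℕ → Set
Ext σ = Maybe (Fin σ)

module _ {A : Set} (_≟A_ : DecidableEquality A) where
  occ : List A → List A → ℕ
  occ P W = length (filter (λ i → ListP.≡-dec _≟A_ P (take (length P) (drop i W)))
                           (upTo (suc (length W))))

occT : ∀ {σ} → Str σ → Str σ → ℕ
occT T P = occ FinP._≟_ P T

T$ : ∀ {σ} → Str σ → List (Ext σ)
T$ T = map just T ∷ʳ nothing

occT$ : ∀ {σ} → Str σ → List (Ext σ) → ℕ
occT$ T P = occ (MaybeP.≡-dec FinP._≟_) P (T$ T)

allExt : ∀ σ → List (Ext σ)
allExt σ = nothing ∷ map just (allFin σ)

ρ : ∀ {σ} → Str σ → Str σ → ℕ
ρ {σ} T S = length (filter (λ y → occT$ T (map just S ∷ʳ y) ≟ 1) (allExt σ))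

Occurs : ∀ {σ} → Str σ → Str σ → Set
Occurs T S = 1 ≤ occT T S

IsSuffix : ∀ {σ} → Str σ → Str σ → Set
IsSuffix T S = ∃ λ i → drop i T ≡ S

RepeatedSuffix : ∀ {σ} → Str σ → Str σ → Set
RepeatedSuffix T S = IsSuffix T S × 2 ≤ occT T S

-- The trie of all suffixes of T: its nodes are the strings S occurring
-- in T (prefixes of suffixes), the node S has a child S c for every
-- letter c such that S c occurs in T.  A trie node is identified with its
-- string; the root is [].

TrieNode : ∀ {σ} → Str σ → Str σ → Set
TrieNode T S = Occurs T S

HasChild : ∀ {σ} → Str σ → Str σ → Fin σ → Set
HasChild T S c = Occurs T (S ∷ʳ c)

Branching : ∀ {σ} → Str σ → Str σ → Set
Branching T S = TrieNode T S × S ≢ [] ×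
  ∃₂ λ c c′ → c ≢ c′ × HasChild T S c × HasChild T S c′

Leaf : ∀ {σ} → Str σ → Str σ → Set
Leaf T S = TrieNode T S × S ≢ [] × (∀ c → ¬ HasChild T S c)

Explicit : ∀ {σ} → Str σ → Str σ → Set
Explicit T S = S ≡ [] ⊎ Branching T S ⊎ Leaf T S

IsParent : ∀ {σ} → Str σ → Str σ → Str σ → Set
IsParent T p u =
  Explicit T p × Explicit T u × length p < length u × p ≡ take (length p) u ×
  (∀ k → length p < k → k < length u → ¬ Explicit T (take k u))

-- str(u) = u, depth(u) = length u.
-- (u , d) is a locus: u non-root explicit node, depth(parent u) < d ≤ depth u.
Locus : ∀ {σ} → Str σ → Str σ → ℕ → Set
Locus T u d = Explicit T u × u ≢ [] ×
  ∃ λ p → IsParent T p u × length p < d × d ≤ length u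

ImplicitNode : ∀ {σ} → Str σ → Str σ → ℕ → Set
ImplicitNode T u d = Locus T u d × RepeatedSuffix T (take d u)

EdgeHasImplicit : ∀ {σ} → Str σ → Str σ → Set
EdgeHasImplicit T w = ∃ λ d → ImplicitNode T w d

HasCard : {X : Set} → (X → Set) → ℕ → Set
HasCard {X} P k = Σ (List X) λ L → Unique L × (∀ x → (x ∈ L) ⇔ P x) × length L ≡ k

module Submission where

-- Write occ P for the number of occurrences of P in T.  For a suffix S of T the
-- string S$ occurs exactly once in T$, and S c occurs as often in T$ as in T, so
-- ρ(S) = 1 + #{c | occ (S c) = 1}.  A string S strictly inside an edge has a
-- single child c₀, and its occurrences are those of S c₀ plus at most one as a
-- suffix.  Inside an internal edge, or above a deeper implicit node, S c₀ occurs
-- at least twice, so ρ(S) = 1.  Between the deepest implicit node of an external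
-- edge and its leaf no string is explicit or a repeated suffix, so occ stays 1
-- all the way up from the leaf to S c₀, and ρ(S) = 2.  At a branching node u the
-- letters c with occ (u c) = 1 correspond one-to-one to the leaf children w of u
-- whose edge carries no implicit node: w is the unique suffix of T starting with u c.

open import Defs

open import Data.Bool using (true; false)
open import Data.Fin using (Fin)
import Data.Fin.Properties as FinP
open import Data.List using (List; []; _∷_; _∷ʳ_; _++_; length; take; drop; map; filter; upTo; allFin)
import Data.List.Properties as ListP
open import Data.List.Properties
  using ( filter-some; filter-none; filter-accept; filter-reject; filter-++; ++-identityʳ; ∷-injective
        ; ∷ʳ-injectiveʳ; length-++; length-map; length-take; length-drop; take-all; take-take; take-[]
        ; drop-all; drop-map; upTo-∷ʳ)
open import Data.List.Membership.Propositional using (_∈_; lose)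
open import Data.List.Membership.Propositional.Properties
  using (∈-filter⁻; ∈-filter⁺; ∈-map⁺; ∈-map⁻; ∈-upTo⁺; ∈-upTo⁻; ∈-allFin)
open import Data.List.Relation.Binary.Sublist.Propositional using (⊆-refl)
import Data.List.Relation.Binary.Sublist.Propositional.Properties as Sublist
import Data.List.Relation.Unary.All as All
open import Data.List.Relation.Unary.All using (_∷_)
open import Data.List.Relation.Unary.AllPairs using (_∷_)
open import Data.List.Relation.Unary.Any using (here; there)
open import Data.List.Relation.Unary.Unique.Propositional using (Unique)
import Data.List.Relation.Unary.Unique.Propositional.Properties as Unique
open import Data.Maybe using (just; nothing)
import Data.Maybe.Properties as MaybeP
open import Data.Nat
  using (ℕ; zero; suc; _≤_; _<_; _+_; _∸_; _⊓_; z≤n; s≤s; s≤s⁻¹; z<s; _≟_; _≤?_; _<?_)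
open import Data.Nat.Properties
  using ( ≤-refl; ≤-reflexive; ≤-trans; ≤-antisym; <-irrefl; <-trans; ≤-<-trans; <-≤-trans; <⇒≤; <⇒≱
        ; ≰⇒>; ≮⇒≥; ≤∧≢⇒<; m<n⇒m<1+n; m<m+n; n≤1⇒n≡0∨n≡1; +-comm; +-suc; +-identityʳ
        ; m+[n∸m]≡n; ∸-cancelˡ-≡; m⊓n≤m; m⊓n≤n; m≤n⇒m⊓n≡m; module ≤-Reasoning)
open import Data.Product using (∃; _×_; _,_; proj₁; proj₂; map₂)
open import Data.Sum using (_⊎_; inj₁; inj₂; [_,_]; [_,_]′)
open import Function.Base using (_∘_; id; flip)
open import Function.Bundles using (_⇔_; Equivalence; mk⇔)
open import Relation.Nullary using (¬_; yes; no; does; contradiction)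
open import Relation.Unary using (Decidable)
open import Relation.Binary.PropositionalEquality
  using (_≡_; _≢_; refl; sym; trans; cong; subst; module ≡-Reasoning)

module _ {X : Set} {P : X → Set} (P? : Decidable P) where

  count : List X → ℕ
  count xs = length (filter P? xs)

  count-pos : ∀ {x xs} → x ∈ xs → P x → 1 ≤ count xs
  count-pos x∈xs px = filter-some P? (lose x∈xs px)

  count-witness : ∀ xs → 1 ≤ count xs → ∃ λ x → x ∈ xs × P x
  count-witness xs h with filter P? xs in eq
  ... | x ∷ _ = x , ∈-filter⁻ P? (subst (x ∈_) (sym eq) (here refl))

  count≡0 : ∀ {xs} → (∀ {x} → x ∈ xs → ¬ P x) → count xs ≡ 0
  count≡0 none = cong length (filter-none P? (All.tabulate none))

  count≤1 : ∀ {xs} → Unique xs → (∀ {x y} → x ∈ xs → y ∈ xs → P x → P y → x ≡ y) →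
            count xs ≤ 1
  count≤1 {xs} xs! same with filter P? xs in eq | Unique.filter⁺ P? xs!
  ... | []        | _               = z≤n
  ... | _ ∷ []    | _               = s≤s z≤n
  ... | x ∷ y ∷ _ | (x≢y ∷ _) ∷ _
    with x∈xs , px ← ∈-filter⁻ P? (subst (x ∈_) (sym eq) (here refl))
       | y∈xs , py ← ∈-filter⁻ P? (subst (y ∈_) (sym eq) (there (here refl)))
    = contradiction (same x∈xs y∈xs px py) x≢y

  count≥2 : ∀ {x y xs} → x ∈ xs → y ∈ xs → x ≢ y → P x → P y → 2 ≤ count xs
  count≥2 {x} {y} x∈xs y∈xs x≢y px py = two-members (∈-filter⁺ P? x∈xs px) (∈-filter⁺ P? y∈xs py)
    where
    two-members : ∀ {zs} → x ∈ zs → y ∈ zs → 2 ≤ length zs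
    two-members (here refl)       (here refl)       = contradiction refl x≢y
    two-members _                 (there (here _))  = s≤s (s≤s z≤n)
    two-members _                 (there (there _)) = s≤s (s≤s z≤n)
    two-members (there (here _))  (here _)          = s≤s (s≤s z≤n)
    two-members (there (there _)) (here _)          = s≤s (s≤s z≤n)

  count-∷ʳ-reject : ∀ {xs x} → ¬ P x → count (xs ∷ʳ x) ≡ count xs
  count-∷ʳ-reject {xs} {x} ¬px = cong length (begin
    filter P? (xs ∷ʳ x)              ≡⟨ filter-++ P? xs (x ∷ []) ⟩
    filter P? xs ++ filter P? (x ∷ []) ≡⟨ cong (filter P? xs ++_) (filter-reject P? ¬px) ⟩
    filter P? xs ++ []               ≡⟨ ++-identityʳ _ ⟩
    filter P? xs                     ∎)
    where open ≡-Reasoning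

  count-map : ∀ {Y : Set} (f : Y → X) xs → count (map f xs) ≡ length (filter (P? ∘ f) xs)
  count-map f []       = refl
  count-map f (x ∷ xs) with does (P? (f x))
  ... | true  = cong suc (count-map f xs)
  ... | false = count-map f xs

module _ {X : Set} {P Q : X → Set} (P? : Decidable P) (Q? : Decidable Q) where

  count-mono : (∀ {x} → P x → Q x) → ∀ xs → count P? xs ≤ count Q? xs
  count-mono P⇒Q xs = Sublist.length-mono-≤ (Sublist.filter⁺ P? Q? (λ { refl → P⇒Q }) (⊆-refl {x = xs}))

  count-cong : ∀ xs → (∀ {x} → x ∈ xs → P x ⇔ Q x) → count P? xs ≡ count Q? xs
  count-cong []       _   = refl
  count-cong (x ∷ xs) P⇔Q with P? x | Q? x
  ... | yes _  | yes _  = cong suc (count-cong xs (P⇔Q ∘ there))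
  ... | no _   | no _   = count-cong xs (P⇔Q ∘ there)
  ... | yes px | no ¬qx = contradiction (Equivalence.to (P⇔Q (here refl)) px) ¬qx
  ... | no ¬px | yes qx = contradiction (Equivalence.from (P⇔Q (here refl)) qx) ¬px

  module _ {R : X → Set} (R? : Decidable R) where

    count-⊎ : (∀ {x} → Q x → ¬ R x) → ∀ xs → (∀ {x} → x ∈ xs → P x ⇔ (Q x ⊎ R x)) →
              count P? xs ≡ count Q? xs + count R? xs
    count-⊎ Q⇒¬R []       _ = refl
    count-⊎ Q⇒¬R (x ∷ xs) P⇔Q⊎R with ih ← count-⊎ Q⇒¬R xs (P⇔Q⊎R ∘ there) | P? x | Q? x | R? x
    ... | _      | yes qx | yes rx = contradiction rx (Q⇒¬R qx)
    ... | yes _  | yes _  | no _   = cong suc ih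
    ... | yes _  | no _   | yes _  = trans (cong suc ih) (sym (+-suc _ _))
    ... | no _   | no _   | no _   = ih
    ... | yes px | no ¬qx | no ¬rx = contradiction (Equivalence.to (P⇔Q⊎R (here refl)) px) [ ¬qx , ¬rx ]
    ... | no ¬px | yes qx | no _   = contradiction (Equivalence.from (P⇔Q⊎R (here refl)) (inj₁ qx)) ¬px
    ... | no ¬px | no _   | yes rx = contradiction (Equivalence.from (P⇔Q⊎R (here refl)) (inj₂ rx)) ¬px

module _ {A : Set} where

  infix 4 _≼_
  _≼_ : List A → List A → Set
  P ≼ X = P ≡ take (length P) X

  ≼-refl : ∀ X → X ≼ X
  ≼-refl X = sym (take-all (length X) X ≤-refl)

  ≼-length : ∀ {P X} → P ≼ X → length P ≤ length X
  ≼-length {P} {X} P≼X = begin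
    length P                       ≡⟨ cong length P≼X ⟩
    length (take (length P) X)     ≡⟨ length-take (length P) X ⟩
    length P ⊓ length X            ≤⟨ m⊓n≤n (length P) (length X) ⟩
    length X                       ∎
    where open ≤-Reasoning

  ≼-take : ∀ {P X k} → P ≼ X → length P ≤ k → P ≼ take k X
  ≼-take {P} {X} {k} P≼X |P|≤k = begin
    P                              ≡⟨ P≼X ⟩
    take (length P) X              ≡⟨ cong (λ n → take n X) (m≤n⇒m⊓n≡m |P|≤k) ⟨
    take (length P ⊓ k) X          ≡⟨ take-take (length P) k X ⟨
    take (length P) (take k X)     ∎
    where open ≡-Reasoning

  ≼-trans : ∀ {Q P X} → Q ≼ P → P ≼ X → Q ≼ X
  ≼-trans {Q} {P} {X} Q≼P P≼X = begin
    Q                                     ≡⟨ Q≼P ⟩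
    take (length Q) P                     ≡⟨ cong (take (length Q)) P≼X ⟩
    take (length Q) (take (length P) X)   ≡⟨ take-take (length Q) (length P) X ⟩
    take (length Q ⊓ length P) X          ≡⟨ cong (λ n → take n X) (m≤n⇒m⊓n≡m (≼-length Q≼P)) ⟩
    take (length Q) X                     ∎
    where open ≡-Reasoning

  take-≼ : ∀ k X → take k X ≼ X
  take-≼ zero    X       = refl
  take-≼ (suc k) []      = refl
  take-≼ (suc k) (x ∷ X) = cong (x ∷_) (take-≼ k X)

  take-≼-take : ∀ {j k} X → j ≤ k → take j X ≼ take k X
  take-≼-take {j} X j≤k =
    ≼-take (take-≼ j X) (≤-trans (≤-reflexive (length-take j X)) (≤-trans (m⊓n≤m j _) j≤k))

  ++-≼ : ∀ S R → S ≼ S ++ R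
  ++-≼ []      R = refl
  ++-≼ (s ∷ S) R = cong (s ∷_) (++-≼ S R)

  ≼-cases : ∀ {S X} → S ≼ X → X ≡ S ⊎ ∃ λ c → S ∷ʳ c ≼ X
  ≼-cases {[]}    {[]}    _   = inj₁ refl
  ≼-cases {[]}    {x ∷ X} _   = inj₂ (x , refl)
  ≼-cases {s ∷ S} {x ∷ X} S≼X with refl , S≼X′ ← ∷-injective S≼X with ≼-cases S≼X′
  ... | inj₁ X≡S       = inj₁ (cong (s ∷_) X≡S)
  ... | inj₂ (c , Sc≼X) = inj₂ (c , cong (s ∷_) Sc≼X)

  ≼-extend : ∀ {S X} → S ≼ X → length S < length X → ∃ λ c → S ∷ʳ c ≼ X
  ≼-extend S≼X |S|<|X| with ≼-cases S≼X
  ... | inj₁ refl = contradiction |S|<|X| (<-irrefl refl)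
  ... | inj₂ ext  = ext

  ≼-∷ʳ-injective : ∀ {S X a b} → S ∷ʳ a ≼ X → S ∷ʳ b ≼ X → a ≡ b
  ≼-∷ʳ-injective {S} {X} {a} {b} Sa≼X Sb≼X = ∷ʳ-injectiveʳ S S (begin
    S ∷ʳ a                      ≡⟨ Sa≼X ⟩
    take (length (S ∷ʳ a)) X    ≡⟨ cong (λ n → take n X) (length-++ S) ⟩
    take (length S + 1) X       ≡⟨ cong (λ n → take n X) (length-++ S) ⟨
    take (length (S ∷ʳ b)) X    ≡⟨ Sb≼X ⟨
    S ∷ʳ b                      ∎)
    where open ≡-Reasoning

  take-suc-∷ʳ : ∀ k (X : List A) → k < length X → ∃ λ c → take (suc k) X ≡ take k X ∷ʳ c
  take-suc-∷ʳ zero    (x ∷ X) _         = x , refl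
  take-suc-∷ʳ (suc k) (x ∷ X) (s≤s k<n) = map₂ (cong (x ∷_)) (take-suc-∷ʳ k X k<n)

  length-∷ʳ : ∀ (X : List A) x → length (X ∷ʳ x) ≡ suc (length X)
  length-∷ʳ X x = trans (length-++ X) (+-comm (length X) 1)

  ∷ʳ-⋠ : ∀ X c → ¬ (X ∷ʳ c ≼ X)
  ∷ʳ-⋠ X c Xc≼X = <-irrefl refl (begin-strict
    length X          <⟨ ≤-reflexive (sym (length-∷ʳ X c)) ⟩
    length (X ∷ʳ c)   ≤⟨ ≼-length Xc≼X ⟩
    length X          ∎)
    where open ≤-Reasoning

  ≼-[] : ∀ {P : List A} → P ≼ [] → P ≡ []
  ≼-[] {P} P≼[] = trans P≼[] (take-[] (length P))

  drop-++ˡ : ∀ {i} (X Y : List A) → i ≤ length X → drop i (X ++ Y) ≡ drop i X ++ Y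
  drop-++ˡ {zero}  X       Y _         = refl
  drop-++ˡ {suc i} (x ∷ X) Y (s≤s i≤n) = drop-++ˡ X Y i≤n

  ∷ʳ≢[] : ∀ (X : List A) y → X ∷ʳ y ≢ []
  ∷ʳ≢[] []      _ ()
  ∷ʳ≢[] (_ ∷ _) _ ()

module _ {A : Set} where

  letter-≼-$ : ∀ (P X : List A) c → (map just P ∷ʳ just c ≼ map just X ∷ʳ nothing) ⇔ (P ∷ʳ c ≼ X)
  letter-≼-$ P X c = mk⇔ (to P X) (from P X)
    where
    to : ∀ P X → map just P ∷ʳ just c ≼ map just X ∷ʳ nothing → P ∷ʳ c ≼ X
    to []      []      ()
    to (_ ∷ _) []      ()
    to []      (x ∷ X) eq with refl , _ ← ∷-injective eq = refl
    to (p ∷ P) (x ∷ X) eq with refl , eq′ ← ∷-injective eq = cong (p ∷_) (to P X eq′)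
    from : ∀ P X → P ∷ʳ c ≼ X → map just P ∷ʳ just c ≼ map just X ∷ʳ nothing
    from []      []      ()
    from (_ ∷ _) []      ()
    from []      (x ∷ X) eq with refl , _ ← ∷-injective eq = refl
    from (p ∷ P) (x ∷ X) eq with refl , eq′ ← ∷-injective eq = cong (just p ∷_) (from P X eq′)

  end-≼-$ : ∀ (P X : List A) → (map just P ∷ʳ nothing ≼ map just X ∷ʳ nothing) ⇔ (X ≡ P)
  end-≼-$ P X = mk⇔ (to P X) (λ { refl → ≼-refl (map just P ∷ʳ nothing) })
    where
    to : ∀ P X → map just P ∷ʳ nothing ≼ map just X ∷ʳ nothing → X ≡ P
    to []      []      _  = refl
    to []      (_ ∷ _) ()
    to (_ ∷ _) []      ()
    to (p ∷ P) (x ∷ X) eq with refl , eq′ ← ∷-injective eq = cong (p ∷_) (to P X eq′)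

module Occurrences {σ : ℕ} (T : Str σ) where

  positions : List ℕ
  positions = upTo (suc (length T))

  ∈-positions : ∀ {i} → i ≤ length T → i ∈ positions
  ∈-positions i≤n = ∈-upTo⁺ (s≤s i≤n)

  positions-≤ : ∀ {i} → i ∈ positions → i ≤ length T
  positions-≤ i∈ = s≤s⁻¹ (∈-upTo⁻ i∈)

  OccursAt : Str σ → ℕ → Set
  OccursAt P i = P ≼ drop i T

  occursAt? : ∀ P → Decidable (OccursAt P)
  occursAt? P i = ListP.≡-dec FinP._≟_ P (take (length P) (drop i T))

  SuffixAt : Str σ → ℕ → Set
  SuffixAt S i = drop i T ≡ S

  suffixAt? : ∀ S → Decidable (SuffixAt S)
  suffixAt? S i = ListP.≡-dec FinP._≟_ (drop i T) S

  suffixCount : Str σ → ℕ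
  suffixCount S = count (suffixAt? S) positions

  occurs-at : ∀ {P i} → i ≤ length T → OccursAt P i → Occurs T P
  occurs-at i≤n = count-pos (occursAt? _) (∈-positions i≤n)

  occurrence : ∀ P → Occurs T P → ∃ λ i → i ≤ length T × OccursAt P i
  occurrence P occurs with i , i∈ , at ← count-witness (occursAt? P) positions occurs = i , positions-≤ i∈ , at

  occT-antitone : ∀ {Q P} → Q ≼ P → occT T P ≤ occT T Q
  occT-antitone Q≼P = count-mono (occursAt? _) (occursAt? _) (≼-trans Q≼P) positions

  occT≡1-unique : ∀ {P i j} → occT T P ≡ 1 → i ≤ length T → j ≤ length T →
                  OccursAt P i → OccursAt P j → i ≡ j
  occT≡1-unique {P} {i} {j} once i≤n j≤n at-i at-j with i ≟ j
  ... | yes i≡j = i≡j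
  ... | no  i≢j = contradiction
    (count≥2 (occursAt? P) (∈-positions i≤n) (∈-positions j≤n) i≢j at-i at-j) (<-irrefl (sym once))

  suffixAt⇒occursAt : ∀ {S i} → SuffixAt S i → OccursAt S i
  suffixAt⇒occursAt {S} eq = subst (S ≼_) (sym eq) (≼-refl S)

  suffixCount≤1 : ∀ S → suffixCount S ≤ 1
  suffixCount≤1 S = count≤1 (suffixAt? S) (Unique.upTo⁺ _) same-position
    where
    same-position : ∀ {i j} → i ∈ positions → j ∈ positions → SuffixAt S i → SuffixAt S j → i ≡ j
    same-position {i} {j} i∈ j∈ at-i at-j = ∸-cancelˡ-≡ (positions-≤ i∈) (positions-≤ j∈) (begin
      length T ∸ i        ≡⟨ length-drop i T ⟨
      length (drop i T)   ≡⟨ cong length (trans at-i (sym at-j)) ⟩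
      length (drop j T)   ≡⟨ length-drop j T ⟩
      length T ∸ j        ∎)
      where open ≡-Reasoning

  suffix-occurrence : ∀ {S} → 1 ≤ suffixCount S → ∃ λ i → i ≤ length T × SuffixAt S i
  suffix-occurrence {S} h with i , i∈ , at ← count-witness (suffixAt? S) positions h = i , positions-≤ i∈ , at

  -- a witness i > length T is moved to position length T: both suffixes are empty
  suffixCount-pos : ∀ {S} → IsSuffix T S → 1 ≤ suffixCount S
  suffixCount-pos {S} (i , at) with i ≤? length T
  ... | yes i≤n = count-pos (suffixAt? S) (∈-positions i≤n) at
  ... | no  i≰n = count-pos (suffixAt? S) (∈-positions ≤-refl)
                    (trans (drop-all (length T) T ≤-refl) (trans (sym (drop-all i T (<⇒≤ (≰⇒> i≰n)))) at))

  occT-childless : ∀ {S} → (∀ c → ¬ HasChild T S c) → occT T S ≡ suffixCount S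
  occT-childless {S} childless = count-cong (occursAt? S) (suffixAt? S) positions
    λ {i} i∈ → mk⇔ (suffix-or-child i∈) (suffixAt⇒occursAt {i = i})
    where
    suffix-or-child : ∀ {i} → i ∈ positions → OccursAt S i → SuffixAt S i
    suffix-or-child i∈ at with ≼-cases at
    ... | inj₁ at′          = at′
    ... | inj₂ (c , at-Sc) = contradiction (occurs-at (positions-≤ i∈) at-Sc) (childless c)

  occT-single-child : ∀ {S c₀} → (∀ c → c ≢ c₀ → ¬ HasChild T S c) →
                      occT T S ≡ suffixCount S + occT T (S ∷ʳ c₀)
  occT-single-child {S} {c₀} no-other = count-⊎ (occursAt? S) (suffixAt? S) (occursAt? (S ∷ʳ c₀))
    (λ {i} → suffix-no-child {i}) positions
    λ {i} i∈ → mk⇔ (suffix-or-child i∈) [ suffixAt⇒occursAt {i = i} , ≼-trans (++-≼ S (c₀ ∷ [])) ]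
    where
    suffix-no-child : ∀ {i} → SuffixAt S i → ¬ OccursAt (S ∷ʳ c₀) i
    suffix-no-child {i} at at-Sc = ∷ʳ-⋠ S c₀ (subst (S ∷ʳ c₀ ≼_) at at-Sc)
    suffix-or-child : ∀ {i} → i ∈ positions → OccursAt S i → SuffixAt S i ⊎ OccursAt (S ∷ʳ c₀) i
    suffix-or-child i∈ at with ≼-cases at
    ... | inj₁ at′ = inj₁ at′
    ... | inj₂ (c , at-Sc) with c FinP.≟ c₀
    ...   | yes refl = inj₂ at-Sc
    ...   | no  c≢c₀ = contradiction (occurs-at (positions-≤ i∈) at-Sc) (no-other c c≢c₀)

  occursAt$? : ∀ Q → Decidable (λ i → Q ≼ drop i (T$ T))
  occursAt$? Q i = ListP.≡-dec (MaybeP.≡-dec FinP._≟_) Q (take (length Q) (drop i (T$ T)))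

  drop-T$ : ∀ {i} → i ≤ length T → drop i (T$ T) ≡ map just (drop i T) ∷ʳ nothing
  drop-T$ {i} i≤n = trans (drop-++ˡ (map just T) _ (subst (i ≤_) (sym (length-map just T)) i≤n))
                          (cong (_∷ʳ nothing) (drop-map i T))

  occT$-positions : ∀ Q → Q ≢ [] → occT$ T Q ≡ count (occursAt$? Q) positions
  occT$-positions Q Q≢[] = begin
    occT$ T Q
      ≡⟨ cong (λ n → count (occursAt$? Q) (upTo (suc n))) length-T$ ⟩
    count (occursAt$? Q) (upTo (suc (suc (length T))))
      ≡⟨ cong (count (occursAt$? Q)) (upTo-∷ʳ _) ⟨
    count (occursAt$? Q) (positions ∷ʳ suc (length T))
      ≡⟨ count-∷ʳ-reject (occursAt$? Q) {positions} {suc (length T)} past-end ⟩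
    count (occursAt$? Q) positions
      ∎
    where
    open ≡-Reasoning
    length-T$ : length (T$ T) ≡ suc (length T)
    length-T$ = trans (length-++ (map just T)) (trans (+-comm _ 1) (cong suc (length-map just T)))
    past-end : ¬ Q ≼ drop (suc (length T)) (T$ T)
    past-end Q≼ = Q≢[] (trans Q≼ (trans (cong (take _) (drop-all _ (T$ T) (≤-reflexive length-T$))) (take-[] _)))

  occT$-letter : ∀ S c → occT$ T (map just S ∷ʳ just c) ≡ occT T (S ∷ʳ c)
  occT$-letter S c = trans (occT$-positions _ (∷ʳ≢[] (map just S) (just c)))
    (count-cong (occursAt$? _) (occursAt? (S ∷ʳ c)) positions λ {i} i∈ →
      subst (λ Z → (map just S ∷ʳ just c ≼ Z) ⇔ (S ∷ʳ c ≼ drop i T))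
            (sym (drop-T$ (positions-≤ i∈))) (letter-≼-$ S (drop i T) c))

  occT$-end : ∀ {S} → IsSuffix T S → occT$ T (map just S ∷ʳ nothing) ≡ 1
  occT$-end {S} sfx = begin
    occT$ T (map just S ∷ʳ nothing)             ≡⟨ occT$-positions _ (∷ʳ≢[] (map just S) nothing) ⟩
    count (occursAt$? (map just S ∷ʳ nothing)) positions
      ≡⟨ count-cong (occursAt$? _) (suffixAt? S) positions (λ {i} i∈ →
           subst (λ Z → (map just S ∷ʳ nothing ≼ Z) ⇔ SuffixAt S i)
                 (sym (drop-T$ (positions-≤ i∈))) (end-≼-$ S (drop i T))) ⟩
    suffixCount S                               ≡⟨ ≤-antisym (suffixCount≤1 S) (suffixCount-pos sfx) ⟩
    1                                           ∎
    where open ≡-Reasoning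

  uniqueExtension? : ∀ S → Decidable (λ c → occT T (S ∷ʳ c) ≡ 1)
  uniqueExtension? S c = occT T (S ∷ʳ c) ≟ 1

  ρ-suffix : ∀ {S} → IsSuffix T S → ρ T S ≡ suc (count (uniqueExtension? S) (allFin σ))
  ρ-suffix {S} sfx = begin
    ρ T S                                           ≡⟨ cong length (filter-accept unique? (occT$-end sfx)) ⟩
    suc (count unique? (map just (allFin σ)))       ≡⟨ cong suc (count-map unique? just (allFin σ)) ⟩
    suc (count (unique? ∘ just) (allFin σ))
      ≡⟨ cong suc (count-cong (unique? ∘ just) (uniqueExtension? S) (allFin σ) λ {c} _ →
           subst (λ n → (n ≡ 1) ⇔ (occT T (S ∷ʳ c) ≡ 1)) (sym (occT$-letter S c)) (mk⇔ id id)) ⟩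
    suc (count (uniqueExtension? S) (allFin σ))     ∎
    where
    open ≡-Reasoning
    unique? : Decidable (λ y → occT$ T (map just S ∷ʳ y) ≡ 1)
    unique? y = occT$ T (map just S ∷ʳ y) ≟ 1

module Trie {σ : ℕ} (T : Str σ) where
  open Occurrences T

  occT≡1-extension : ∀ {P Q} → occT T P ≡ 1 → P ≼ Q → Occurs T Q → occT T Q ≡ 1
  occT≡1-extension once P≼Q occurs = ≤-antisym (≤-trans (occT-antitone P≼Q) (≤-reflexive once)) occurs

  two-children⇒repeated : ∀ S {c c′} → c ≢ c′ → HasChild T S c → HasChild T S c′ → 2 ≤ occT T S
  two-children⇒repeated S {c} {c′} c≢c′ has-c has-c′
    with i , i≤n , at-i ← occurrence (S ∷ʳ c) has-c | j , j≤n , at-j ← occurrence (S ∷ʳ c′) has-c′ =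
    count≥2 (occursAt? S) (∈-positions i≤n) (∈-positions j≤n) i≢j
            (≼-trans (++-≼ S _) at-i) (≼-trans (++-≼ S _) at-j)
    where
    i≢j : i ≢ j
    i≢j refl = c≢c′ (≼-∷ʳ-injective at-i at-j)

  occT≡1⇒¬Branching : ∀ {S} → occT T S ≡ 1 → ¬ Branching T S
  occT≡1⇒¬Branching {S} once (_ , _ , _ , _ , c≢c′ , has-c , has-c′) =
    <-irrefl (sym once) (two-children⇒repeated S c≢c′ has-c has-c′)

  nonExplicit-unique-child : ∀ {S c₀} → ¬ Explicit T S → HasChild T S c₀ →
                             ∀ c → c ≢ c₀ → ¬ HasChild T S c
  nonExplicit-unique-child {S} {c₀} ¬explicit has-c₀ c c≢c₀ has-c =
    ¬explicit (inj₂ (inj₁ (occurs , (¬explicit ∘ inj₁) , c , c₀ , c≢c₀ , has-c , has-c₀)))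
    where
    occurs : Occurs T S
    occurs = ≤-trans has-c₀ (occT-antitone (++-≼ S (c₀ ∷ [])))

  internal-node-repeated : ∀ {S} → Explicit T S → S ≢ [] → ¬ Leaf T S → 2 ≤ occT T S
  internal-node-repeated {S} explicit S≢[] ¬leaf =
    [ flip contradiction S≢[]
    , [ (λ (_ , _ , _ , _ , c≢c′ , has-c , has-c′) → two-children⇒repeated S c≢c′ has-c has-c′)
      , flip contradiction ¬leaf ]′ ]′ explicit

  occT-leaf : ∀ {S} → Leaf T S → occT T S ≡ 1
  occT-leaf {S} (occurs , _ , childless) =
    ≤-antisym (≤-trans (≤-reflexive (occT-childless childless)) (suffixCount≤1 S)) occurs

  leaf-suffix : ∀ {S} → Leaf T S → ∃ λ i → i ≤ length T × SuffixAt S i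
  leaf-suffix (occurs , _ , childless) =
    suffix-occurrence (≤-trans occurs (≤-reflexive (occT-childless childless)))

  -- occ S = [S is a suffix] + occ (S c), and a suffix occurrence would make S a repeated suffix
  occT≡1-parent : ∀ {S c} → ¬ Explicit T S → ¬ RepeatedSuffix T S →
                  occT T (S ∷ʳ c) ≡ 1 → occT T S ≡ 1
  occT≡1-parent {S} {c} ¬explicit ¬repeated once =
    [ (λ never → trans decomposition (cong (_+ 1) never))
    , (λ once′ → contradiction (repeated once′) ¬repeated)
    ]′ (n≤1⇒n≡0∨n≡1 (suffixCount≤1 S))
    where
    decomposition : occT T S ≡ suffixCount S + 1
    decomposition = trans (occT-single-child (nonExplicit-unique-child ¬explicit (≤-reflexive (sym once))))
                          (cong (suffixCount S +_) once)
    repeated : suffixCount S ≡ 1 → RepeatedSuffix T S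
    repeated once′ with i , _ , at ← suffix-occurrence (≤-reflexive (sym once′)) =
      (i , at) , ≤-reflexive (sym (trans decomposition (cong (_+ 1) once′)))

  occT≡1-along-edge : ∀ {w d} → occT T w ≡ 1 →
    (∀ k → d < k → k < length w → ¬ Explicit T (take k w) × ¬ RepeatedSuffix T (take k w)) →
    ∀ {k} → d < k → k ≤ length w → occT T (take k w) ≡ 1
  occT≡1-along-edge {w} {d} once interior {k} d<k k≤w = climb (length w ∸ k) (m+[n∸m]≡n k≤w) d<k
    where
    climb : ∀ {k} n → k + n ≡ length w → d < k → occT T (take k w) ≡ 1
    climb {k} zero    k+0≡w _   =
      trans (cong (occT T) (take-all k w (≤-reflexive (trans (sym k+0≡w) (+-identityʳ k))))) once
    climb {k} (suc n) k+n≡w d<k =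
      occT≡1-parent (proj₁ (interior k d<k k<w)) (proj₂ (interior k d<k k<w))
        (subst (λ S → occT T S ≡ 1) (proj₂ step) (climb n (trans (sym (+-suc k n)) k+n≡w) (m<n⇒m<1+n d<k)))
      where
      k<w : k < length w
      k<w = subst (k <_) k+n≡w (m<m+n k z<s)
      step : ∃ λ c → take (suc k) w ≡ take k w ∷ʳ c
      step = take-suc-∷ʳ k w k<w

  explicit-prefix-above-parent : ∀ {p w v} → IsParent T p w → Explicit T v → v ≼ w → length v < length w →
                                 length v ≤ length p
  explicit-prefix-above-parent {p} {w} {v} (_ , _ , _ , _ , no-explicit-between) explicit-v v≼w v<w
    with length p <? length v
  ... | yes p<v = contradiction (subst (Explicit T) v≼w explicit-v) (no-explicit-between (length v) p<v v<w)
  ... | no  p≮v = ≮⇒≥ p≮v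

  ρ-nonExplicit-repeated-child : ∀ {S c₀} → ¬ Explicit T S → IsSuffix T S →
                                 2 ≤ occT T (S ∷ʳ c₀) → ρ T S ≡ 1
  ρ-nonExplicit-repeated-child {S} {c₀} ¬explicit suffix twice =
    trans (ρ-suffix suffix) (cong suc (count≡0 (uniqueExtension? S) ¬unique))
    where
    ¬unique : ∀ {c} → c ∈ allFin σ → ¬ occT T (S ∷ʳ c) ≡ 1
    ¬unique {c} _ once with c FinP.≟ c₀
    ... | yes refl = <-irrefl (sym once) twice
    ... | no  c≢c₀ = nonExplicit-unique-child ¬explicit (<⇒≤ twice) c c≢c₀ (≤-reflexive (sym once))

  ρ-nonExplicit-unique-child : ∀ {S c₀} → ¬ Explicit T S → IsSuffix T S →
                               occT T (S ∷ʳ c₀) ≡ 1 → ρ T S ≡ 2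
  ρ-nonExplicit-unique-child {S} {c₀} ¬explicit suffix once = trans (ρ-suffix suffix) (cong suc (≤-antisym
    (count≤1 (uniqueExtension? S) (Unique.allFin⁺ σ) λ _ _ once-c once-c′ →
       trans (is-c₀ once-c) (sym (is-c₀ once-c′)))
    (count-pos (uniqueExtension? S) (∈-allFin c₀) once)))
    where
    is-c₀ : ∀ {c} → occT T (S ∷ʳ c) ≡ 1 → c ≡ c₀
    is-c₀ {c} once-c with c FinP.≟ c₀
    ... | yes c≡c₀ = c≡c₀
    ... | no  c≢c₀ = contradiction (≤-reflexive (sym once-c))
                       (nonExplicit-unique-child ¬explicit (≤-reflexive (sym once)) c c≢c₀)

  module _ {p u d} (parent : IsParent T p u) (p<d : length p < d) (d<u : d < length u)
           (suffix : IsSuffix T (take d u)) where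

    private
      below-¬explicit : ∀ {k} → d ≤ k → k < length u → ¬ Explicit T (take k u)
      below-¬explicit d≤k = proj₂ (proj₂ (proj₂ (proj₂ parent))) _ (<-≤-trans p<d d≤k)
      ¬explicit : ¬ Explicit T (take d u)
      ¬explicit = below-¬explicit ≤-refl d<u
      next : ∃ λ c → take (suc d) u ≡ take d u ∷ʳ c
      next = take-suc-∷ʳ d u d<u

    ρ-edge-repeated-below : 2 ≤ occT T (take (suc d) u) → ρ T (take d u) ≡ 1
    ρ-edge-repeated-below twice =
      ρ-nonExplicit-repeated-child ¬explicit suffix (subst (λ S → 2 ≤ occT T S) (proj₂ next) twice)

    ρ-edge-unique-below : occT T (take (suc d) u) ≡ 1 → ρ T (take d u) ≡ 2
    ρ-edge-unique-below once =
      ρ-nonExplicit-unique-child ¬explicit suffix (subst (λ S → occT T S ≡ 1) (proj₂ next) once)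

    ρ-edge-deepest : Leaf T u → (∀ k → d < k → k < length u → ¬ RepeatedSuffix T (take k u)) →
                     ρ T (take d u) ≡ 2
    ρ-edge-deepest leaf ¬repeated = ρ-edge-unique-below
      (occT≡1-along-edge (occT-leaf leaf) (λ k d<k k<u → below-¬explicit (<⇒≤ d<k) k<u , ¬repeated k d<k k<u)
                         ≤-refl d<u)

  -- The fallback P keeps P ≼ firstSuffixWith P true even when P does not occur.
  firstSuffixWith : Str σ → Str σ
  firstSuffixWith P with filter (occursAt? P) positions
  ... | []    = P
  ... | i ∷ _ = drop i T

  ≼-firstSuffixWith : ∀ P → P ≼ firstSuffixWith P
  ≼-firstSuffixWith P with filter (occursAt? P) positions in eq
  ... | []    = ≼-refl P
  ... | i ∷ _ = proj₂ (∈-filter⁻ (occursAt? P) (subst (i ∈_) (sym eq) (here refl)))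

  firstSuffixWith-occurrence : ∀ {P} → Occurs T P →
    ∃ λ i → i ≤ length T × OccursAt P i × firstSuffixWith P ≡ drop i T
  firstSuffixWith-occurrence {P} occurs with filter (occursAt? P) positions in eq
  ... | []    = contradiction occurs λ ()
  ... | i ∷ _ with i∈ , at ← ∈-filter⁻ (occursAt? P) (subst (i ∈_) (sym eq) (here refl)) =
    i , positions-≤ i∈ , at , refl

  unique-occurrence-leaf : ∀ {P i} → occT T P ≡ 1 → P ≢ [] → i ≤ length T → OccursAt P i →
                           Leaf T (drop i T)
  unique-occurrence-leaf {P} {i} once P≢[] i≤n at =
    occurs-at {i = i} i≤n (≼-refl (drop i T)) , nonempty , childless
    where
    nonempty : drop i T ≢ []
    nonempty empty = P≢[] (≼-[] (subst (P ≼_) empty at))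
    childless : ∀ c → ¬ HasChild T (drop i T) c
    childless c has-c with j , j≤n , at-j ← occurrence (drop i T ∷ʳ c) has-c
      with refl ← occT≡1-unique once j≤n i≤n (≼-trans (≼-trans at (++-≼ _ (c ∷ []))) at-j) at =
      ∷ʳ-⋠ (drop i T) c at-j

  unique-occurrence-interior : ∀ {P Q i} → occT T P ≡ 1 → P ≢ [] → i ≤ length T → OccursAt P i →
    P ≼ Q → Q ≼ drop i T → length Q < length (drop i T) → ¬ Explicit T Q
  unique-occurrence-interior _ P≢[] _ _ P≼Q _ _ (inj₁ refl) = P≢[] (≼-[] P≼Q)
  unique-occurrence-interior once _ i≤n _ P≼Q Q≼ _ (inj₂ (inj₁ branching)) =
    occT≡1⇒¬Branching (occT≡1-extension once P≼Q (occurs-at i≤n Q≼)) branching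
  unique-occurrence-interior _ _ i≤n _ _ Q≼ Q< (inj₂ (inj₂ (_ , _ , childless))) =
    childless (proj₁ (≼-extend Q≼ Q<)) (occurs-at i≤n (proj₂ (≼-extend Q≼ Q<)))

  module LeafChildren {u} (branching : Branching T u) where

    LeafChildWithoutImplicit : Str σ → Set
    LeafChildWithoutImplicit w = IsParent T u w × Leaf T w × ¬ EdgeHasImplicit T w

    leafChild : Fin σ → Str σ
    leafChild c = firstSuffixWith (u ∷ʳ c)

    leafChild-injective : ∀ {c c′} → leafChild c ≡ leafChild c′ → c ≡ c′
    leafChild-injective {c} {c′} eq =
      ≼-∷ʳ-injective (≼-firstSuffixWith (u ∷ʳ c))
                     (subst (u ∷ʳ c′ ≼_) (sym eq) (≼-firstSuffixWith (u ∷ʳ c′)))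

    suffix-after-unique-child : ∀ {c i} → occT T (u ∷ʳ c) ≡ 1 → i ≤ length T → OccursAt (u ∷ʳ c) i →
                                LeafChildWithoutImplicit (drop i T)
    suffix-after-unique-child {c} {i} once i≤n at = parent , leaf , no-implicit
      where
      w = drop i T
      uc≼ : ∀ {k} → length u < k → u ∷ʳ c ≼ take k w
      uc≼ u<k = ≼-take at (subst (_≤ _) (sym (length-∷ʳ u c)) u<k)
      u≼w : u ≼ w
      u≼w = ≼-trans (++-≼ u (c ∷ [])) at
      u<w : length u < length w
      u<w = subst (_≤ length w) (length-∷ʳ u c) (≼-length at)
      leaf : Leaf T w
      leaf = unique-occurrence-leaf once (∷ʳ≢[] u c) i≤n at
      parent : IsParent T u w
      parent = inj₂ (inj₁ branching) , inj₂ (inj₂ leaf) , u<w , u≼w ,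
        λ k u<k k<w → unique-occurrence-interior once (∷ʳ≢[] u c) i≤n at (uc≼ u<k) (take-≼ k w)
                        (≤-<-trans (≤-trans (≤-reflexive (length-take k w)) (m⊓n≤m k _)) k<w)
      no-implicit : ¬ EdgeHasImplicit T w
      no-implicit (d′ , (_ , _ , p′ , parent′ , p′<d′ , _) , _ , repeated) =
        <-irrefl (sym (occT≡1-extension once (uc≼ u<d′) (<⇒≤ repeated))) repeated
        where
        u<d′ : length u < d′
        u<d′ = ≤-<-trans (explicit-prefix-above-parent parent′ (inj₂ (inj₁ branching)) u≼w u<w) p′<d′

    leafChild-sound : ∀ {c} → occT T (u ∷ʳ c) ≡ 1 → LeafChildWithoutImplicit (leafChild c)
    leafChild-sound once with i , i≤n , at , first≡ ← firstSuffixWith-occurrence (≤-reflexive (sym once)) =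
      subst LeafChildWithoutImplicit (sym first≡) (suffix-after-unique-child once i≤n at)

    leafChild-complete : ∀ {w} → LeafChildWithoutImplicit w →
                         ∃ λ c → occT T (u ∷ʳ c) ≡ 1 × leafChild c ≡ w
    leafChild-complete {w} (parent@(_ , explicit-w , u<w , u≼w , no-explicit-between) , leaf , no-implicit) =
      c , once , leafChild≡w
      where
      c = proj₁ (≼-extend u≼w u<w)
      uc≼w : u ∷ʳ c ≼ w
      uc≼w = proj₂ (≼-extend u≼w u<w)
      interior : ∀ k → length u < k → k < length w → ¬ Explicit T (take k w) × ¬ RepeatedSuffix T (take k w)
      interior k u<k k<w = no-explicit-between k u<k k<w ,
        λ repeated → no-implicit
          (k , (explicit-w , proj₁ (proj₂ leaf) , u , parent , u<k , <⇒≤ k<w) , repeated)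
      once : occT T (u ∷ʳ c) ≡ 1
      once = trans (cong (occT T) uc≼w)
                   (occT≡1-along-edge (occT-leaf leaf) interior
                      (≤-reflexive (sym (length-∷ʳ u c))) (≼-length uc≼w))
      leafChild≡w : leafChild c ≡ w
      leafChild≡w with i , i≤n , at-i , first≡ ← firstSuffixWith-occurrence (≤-reflexive (sym once))
                     | j , j≤n , suffix-j ← leaf-suffix leaf
        with refl ← occT≡1-unique once i≤n j≤n at-i (subst (u ∷ʳ c ≼_) (sym suffix-j) uc≼w) =
        trans first≡ suffix-j

    ρ-branching : IsSuffix T u → ∃ λ k → HasCard LeafChildWithoutImplicit k × ρ T u ≡ suc k
    ρ-branching suffix =
      count (uniqueExtension? u) (allFin σ) ,
      (map leafChild uniqueChildren , unique , membership , length-map leafChild uniqueChildren) ,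
      ρ-suffix suffix
      where
      uniqueChildren : List (Fin σ)
      uniqueChildren = filter (uniqueExtension? u) (allFin σ)
      unique : Unique (map leafChild uniqueChildren)
      unique = Unique.map⁺ leafChild-injective (Unique.filter⁺ (uniqueExtension? u) (Unique.allFin⁺ σ))
      membership : ∀ w → (w ∈ map leafChild uniqueChildren) ⇔ LeafChildWithoutImplicit w
      membership w = mk⇔ to from
        where
        to : w ∈ map leafChild uniqueChildren → LeafChildWithoutImplicit w
        to w∈ with c , c∈ , refl ← ∈-map⁻ leafChild w∈ =
          leafChild-sound (proj₂ (∈-filter⁻ (uniqueExtension? u) {xs = allFin σ} c∈))
        from : LeafChildWithoutImplicit w → w ∈ map leafChild uniqueChildren
        from child with c , once , refl ← leafChild-complete child =
          ∈-map⁺ leafChild (∈-filter⁺ (uniqueExtension? u) (∈-allFin c) once)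

lemma4 : ∀ {σ : ℕ} (T : List (Fin σ)) (u : List (Fin σ)) (d : ℕ) →
    ImplicitNode T u d →
    ((¬ Leaf T u → d < length u → ρ T (take d u) ≡ 1) ×
     (d ≡ length u → Branching T u →
        ∃ λ k → HasCard (λ w → IsParent T u w × Leaf T w × ¬ EdgeHasImplicit T w) k
              × ρ T (take d u) ≡ suc k) ×
     (Leaf T u → (∀ d′ → ImplicitNode T u d′ → d′ ≤ d) → ρ T (take d u) ≡ 2) ×
     (Leaf T u → (∃ λ d′ → ImplicitNode T u d′ × d < d′) → ρ T (take d u) ≡ 1))
lemma4 T u d ((explicit-u , u≢[] , p , parent , p<d , d≤u) , suffix , repeated) =
  internal-edge , branching-node , deepest , not-deepest
  where
  open Occurrences T
  open Trie T

  whole : d ≡ length u → take d u ≡ u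
  whole d≡u = take-all d u (≤-reflexive (sym d≡u))

  internal-edge : ¬ Leaf T u → d < length u → ρ T (take d u) ≡ 1
  internal-edge ¬leaf d<u = ρ-edge-repeated-below parent p<d d<u suffix
    (≤-trans (internal-node-repeated explicit-u u≢[] ¬leaf) (occT-antitone (take-≼ (suc d) u)))

  branching-node : d ≡ length u → (branching : Branching T u) →
    ∃ λ k → HasCard (LeafChildren.LeafChildWithoutImplicit branching) k × ρ T (take d u) ≡ suc k
  branching-node d≡u branching =
    subst (λ S → ∃ λ k → HasCard LeafChildWithoutImplicit k × ρ T S ≡ suc k) (sym (whole d≡u))
          (ρ-branching (subst (IsSuffix T) (whole d≡u) suffix))
    where open LeafChildren branching

  deepest : Leaf T u → (∀ d′ → ImplicitNode T u d′ → d′ ≤ d) → ρ T (take d u) ≡ 2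
  deepest leaf maximal = ρ-edge-deepest parent p<d d<u suffix leaf λ k d<k k<u repeated-k →
    <⇒≱ d<k (maximal k ((explicit-u , u≢[] , p , parent , <-trans p<d d<k , <⇒≤ k<u) , repeated-k))
    where
    d<u : d < length u
    d<u = ≤∧≢⇒< d≤u λ d≡u → <-irrefl (sym (trans (cong (occT T) (whole d≡u)) (occT-leaf leaf))) repeated

  not-deepest : Leaf T u → (∃ λ d′ → ImplicitNode T u d′ × d < d′) → ρ T (take d u) ≡ 1
  not-deepest _ (d′ , ((_ , _ , _ , _ , _ , d′≤u) , _ , repeated′) , d<d′) =
    ρ-edge-repeated-below parent p<d (<-≤-trans d<d′ d′≤u) suffix
      (≤-trans repeated′ (occT-antitone (take-≼-take u d<d′)))
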